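{- Let $k,\ell\in\mathbb{N}$ and let $G$ be an $\ell$-empty ordered graph. If the irreducible block decomposition of $G$ has a block of size at least $4k\ell$, then $S_n(G)\geqslant F_{n,\ell}$ for each $n\leqslant k$.
   Context: An ordered graph of order $n$ is a graph on vertex set $[n]$ with the natural order. The length of an edge $ij$ is $|i-j|$; $G$ is $\ell$-empty if it has no edge of length at least $\ell$. A pair of vertices $u<v$ separates the edges of $G$ if every edge $ij$ with $i<j$ satisfies $j\leqslant u$ or $v\leqslant i$; $G$ is irreducible if no pair separates its edges. The irreducible block decomposition of $G$ is the unique partition of $V(G)$ into intervals of consecutive vertices, each inducing an irreducible ordered graph, with no edges between different intervals. $S_n(G)$ is the number of distinct (non-isomorphic as ordered graphs) induced ordered subgraphs of $G$ of order $n$. $F_{n,\ell}=0$ for $n<0$, $F_{0,\ell}=1$, $F_{n,\ell}=F_{n-1,\ell}+\cdots+F_{n-\ell,\ell}$ for $n\ge1$. -}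

module Defs where

open import Data.Nat using (ℕ; zero; suc; _+_; _*_; _≤_; _<_)
open import Data.Nat.Properties using (+-monoʳ-<; <-≤-trans)
open import Data.Bool using (Bool; true; false)
open import Data.Bool.Properties using () renaming (_≟_ to _≟B_)
open import Data.Fin using (Fin; toℕ; fromℕ<)
open import Data.Fin.Properties using (toℕ<n)
open import Data.List using (List; []; _∷_; map; _++_; length; take; deduplicate; allFin)
open import Data.Nat.ListAction using (sum)
open import Data.List.Properties using (≡-dec)
open import Data.List.Membership.Propositional using (_∈_)
open import Data.List.Relation.Unary.All using (All)
open import Data.Product using (Σ; ∃; _×_; _,_)
open import Data.Sum using (_⊎_)
open import Relation.Nullary using (¬_)
open import Relation.Binary.PropositionalEquality using (_≡_)

-- Ordered graphs of order N: vertex set Fin N (vertex x ↔ x+1 ∈ [N]),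
-- ordered by the natural order; simple undirected graphs.

record OGraph (N : ℕ) : Set where
  field
    adj    : Fin N → Fin N → Bool
    sym    : ∀ i j → adj i j ≡ adj j i
    irrefl : ∀ i → adj i i ≡ false
open OGraph public

Edge : ∀ {N} → OGraph N → Fin N → Fin N → Set
Edge G i j = adj G i j ≡ true

LEmpty : ℕ → ∀ {N} → OGraph N → Set
LEmpty ℓ {N} G = ∀ (i j : Fin N) → toℕ i < toℕ j → Edge G i j → toℕ j < toℕ i + ℓ

Separates : ∀ {N} → OGraph N → Fin N → Fin N → Set
Separates {N} G u v =
  ∀ (i j : Fin N) → toℕ i < toℕ j → Edge G i j → (toℕ j ≤ toℕ u) ⊎ (toℕ v ≤ toℕ i)

Irreducible : ∀ {N} → OGraph N → Set
Irreducible {N} G = ∀ (u v : Fin N) → toℕ u < toℕ v → ¬ Separates G u v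

record Block (N : ℕ) : Set where
  field
    start    : ℕ
    size     : ℕ
    nonempty : 1 ≤ size
    bound    : start + size ≤ N
open Block public

InBlock : ∀ {N} → Block N → Fin N → Set
InBlock b i = start b ≤ toℕ i × toℕ i < start b + size b

embed : ∀ {N} (b : Block N) → Fin (size b) → Fin N
embed b x = fromℕ< (<-≤-trans (+-monoʳ-< (start b) (toℕ<n x)) (bound b))

induced : ∀ {N} (b : Block N) → OGraph N → OGraph (size b)
induced b G = record
  { adj    = λ x y → adj G (embed b x) (embed b y)
  ; sym    = λ x y → sym G (embed b x) (embed b y)
  ; irrefl = λ x → irrefl G (embed b x)
  }

Consecutive : ∀ {N} → ℕ → List (Block N) → Set
Consecutive {N} a []       = a ≡ N
Consecutive {N} a (b ∷ bs) = start b ≡ a × Consecutive (start b + size b) bs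

IsIrredBlockDecomp : ∀ {N} → OGraph N → List (Block N) → Set
IsIrredBlockDecomp {N} G D =
    Consecutive 0 D
  × All (λ b → Irreducible (induced b G)) D
  × (∀ (i j : Fin N) → Edge G i j → ∃ λ b → b ∈ D × InBlock b i × InBlock b j)

-- An induced ordered subgraph on vertices v₁ < … < vₙ is, up to ordered
-- isomorphism, determined by its adjacency matrix (adj vₐ v_b)_{a,b}.

subsets : ∀ {A : Set} → ℕ → List A → List (List A)
subsets zero    xs       = [] ∷ []
subsets (suc n) []       = []
subsets (suc n) (x ∷ xs) = map (x ∷_) (subsets n xs) ++ subsets (suc n) xs

adjMatrix : ∀ {N} → OGraph N → List (Fin N) → List (List Bool)
adjMatrix G vs = map (λ u → map (λ v → adj G u v) vs) vs

S : ℕ → ∀ {N} → OGraph N → ℕ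
S n {N} G = length (deduplicate (≡-dec (≡-dec _≟B_))
                       (map (adjMatrix G) (subsets n (allFin N))))

-- F_{n,ℓ}: F_{<0}=0, F_0 = 1, F_n = F_{n-1} + … + F_{n-ℓ}.
-- hist ℓ n = [F_n, F_{n-1}, …, F_0]

hist : ℕ → ℕ → List ℕ
hist ℓ zero    = 1 ∷ []
hist ℓ (suc n) = sum (take ℓ (hist ℓ n)) ∷ hist ℓ n

headOr0 : List ℕ → ℕ
headOr0 []      = 0
headOr0 (x ∷ _) = x

F : ℕ → ℕ → ℕ
F n ℓ = headOr0 (hist ℓ n)

-- Say that an ordered graph on v₁ < ⋯ < vₙ has a cut after q vertices if no edge joins
-- {v₁,…,v_q} to the rest.  In an irreducible block every gap between consecutive vertices is
-- crossed by an edge, and ℓ-emptiness makes these edges short; this yields, in any window of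
-- length 3ℓ of the block, c + 1 vertices (c < ℓ) with no cut before the last one.  Put in front
-- of an (n − c − 1)-set chosen recursively 4ℓ further to the right, they give an n-set whose
-- first cut is after exactly c + 1 vertices.  Different c give different first cuts, and
-- distinct recursive choices stay distinct behind a common prefix, so the counts of induced
-- subgraphs of order n follow the recursion F_{n,ℓ} = F_{n−1,ℓ} + ⋯ + F_{n−ℓ,ℓ} as long as the
-- block has room for n windows of length 4ℓ.

module Submission where

open import Defs hiding (sym)
open import Data.Nat using (ℕ; zero; suc; _+_; _*_; _∸_; _≤_; _<_; z≤n; s≤s; z<s; _≤?_; _<?_; _≟_)
open import Data.Nat.Properties
open import Relation.Binary.Definitions using (tri<; tri≈; tri>)
open import Data.Bool using (Bool; true; false)
open import Data.Bool.Properties using (¬-not) renaming (_≟_ to _≟ᵇ_)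
import Data.Fin as Fin
open import Data.Fin using (Fin; toℕ; fromℕ<)
open import Data.Fin.Properties using (toℕ-fromℕ<; fromℕ<-toℕ; toℕ<n; any?)
open import Data.List using (List; []; _∷_; [_]; map; _++_; length; take; drop; tabulate; allFin; deduplicate)
open import Data.List.Properties using (map-∘; map-cong; take-map; drop-map; take-[]; length-++; length-map; ≡-dec)
open import Data.List.Membership.Propositional using (_∈_)
open import Data.List.Membership.Propositional.Properties using (∈-++⁺ˡ; ∈-++⁺ʳ; ∈-++⁻; ∈-map⁺; ∈-deduplicate⁺)
open import Data.List.Relation.Unary.Any as Any using (Any; here; there)
open import Data.List.Relation.Unary.All as All using (All; []; _∷_)
import Data.List.Relation.Unary.All.Properties as All
open import Data.List.Relation.Unary.AllPairs using (AllPairs; []; _∷_)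
import Data.List.Relation.Unary.AllPairs as AllPairs
import Data.List.Relation.Unary.AllPairs.Properties as AllPairs
open import Data.List.Relation.Binary.Sublist.Heterogeneous using (Sublist; []; _∷_; _∷ʳ_)
open import Data.List.Relation.Binary.Pointwise using (Pointwise; []; _∷_)
open import Data.Product using (Σ; ∃; ∃₂; _×_; _,_; proj₁; proj₂)
open import Data.Empty using (⊥-elim)
open import Data.Nat.Tactic.RingSolver using (solve-∀)
open import Data.Nat.Induction using (<-rec)
open import Data.Nat.ListAction using (sum)
open import Data.Sum using (_⊎_; inj₁; inj₂) renaming ([_,_] to either)
open import Relation.Unary using (_∪_)
open import Function using (_∘_; id; case_of_)
open import Relation.Nullary using (¬_; yes; no)
open import Relation.Nullary.Decidable using (_×-dec_)
open import Relation.Binary.PropositionalEquality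
  using (_≡_; _≢_; refl; sym; trans; cong; cong₂; subst; subst₂; module ≡-Reasoning)

module _ {A : Set} where

  remove : (ys : List A) {x : A} → x ∈ ys → List A
  remove (y ∷ ys) (here _)  = ys
  remove (y ∷ ys) (there p) = y ∷ remove ys p

  length-remove : ∀ ys {x} (p : x ∈ ys) → suc (length (remove ys p)) ≡ length ys
  length-remove (y ∷ ys) (here _)  = refl
  length-remove (y ∷ ys) (there p) = cong suc (length-remove ys p)

  ∈-remove : ∀ ys {x z} (p : x ∈ ys) → z ∈ ys → x ≢ z → z ∈ remove ys p
  ∈-remove (y ∷ ys) (here refl) (here refl) x≢z = ⊥-elim (x≢z refl)
  ∈-remove (y ∷ ys) (here refl) (there q)   _   = q
  ∈-remove (y ∷ ys) (there p)   (here refl) _   = here refl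
  ∈-remove (y ∷ ys) (there p)   (there q)   x≢z = there (∈-remove ys p q x≢z)

  unique⊆⇒length≤ : ∀ {xs ys : List A} →
    AllPairs _≢_ xs → All (_∈ ys) xs → length xs ≤ length ys
  unique⊆⇒length≤ {[]}     _              _ = z≤n
  unique⊆⇒length≤ {x ∷ xs} {ys} (x∉xs ∷ u) (x∈ys ∷ xs⊆ys) =
    subst (suc (length xs) ≤_) (length-remove ys x∈ys)
      (s≤s (unique⊆⇒length≤ u
        (All.zipWith (λ (x≢z , z∈ys) → ∈-remove ys x∈ys z∈ys x≢z) (x∉xs , xs⊆ys))))

  take-length-++ : ∀ (xs ys : List A) → take (length xs) (xs ++ ys) ≡ xs
  take-length-++ []       ys = refl
  take-length-++ (x ∷ xs) ys = cong (x ∷_) (take-length-++ xs ys)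

  drop-length-++ : ∀ (xs ys : List A) → drop (length xs) (xs ++ ys) ≡ ys
  drop-length-++ []       ys = refl
  drop-length-++ (x ∷ xs) ys = drop-length-++ xs ys

  take-++ˡ : ∀ q (xs ys : List A) → q ≤ length xs → take q (xs ++ ys) ≡ take q xs
  take-++ˡ zero    xs       ys _         = refl
  take-++ˡ (suc q) (x ∷ xs) ys (s≤s q≤) = cong (x ∷_) (take-++ˡ q xs ys q≤)

  drop-++ˡ : ∀ q (xs ys : List A) → q ≤ length xs → drop q (xs ++ ys) ≡ drop q xs ++ ys
  drop-++ˡ zero    xs       ys _         = refl
  drop-++ˡ (suc q) (x ∷ xs) ys (s≤s q≤) = drop-++ˡ q xs ys q≤

sublist⇒∈subsets : ∀ {A B : Set} {R : A → B → Set} {xs ys} → Sublist R xs ys →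
  ∃ λ zs → zs ∈ subsets (length xs) ys × Pointwise R xs zs
sublist⇒∈subsets []                = [] , here refl , []
sublist⇒∈subsets {xs = []} (y ∷ʳ _) = [] , here refl , []
sublist⇒∈subsets {xs = _ ∷ _} (y ∷ʳ p) with sublist⇒∈subsets p
... | zs , zs∈ , xs∼zs = zs , ∈-++⁺ʳ _ zs∈ , xs∼zs
sublist⇒∈subsets (x∼y ∷ p) with sublist⇒∈subsets p
... | zs , zs∈ , xs∼zs = _ ∷ zs , ∈-++⁺ˡ (∈-map⁺ (_ ∷_) zs∈) , x∼y ∷ xs∼zs

Within : ℕ → ℕ → ℕ → Set
Within a b x = a ≤ x × x < b

within-suc : ∀ {a c x} → a < x → Within a (a + suc c) x → Within (suc a) (suc a + c) x
within-suc {a} {c} {x} a<x (_ , x<) = a<x , subst (x <_) (+-suc a c) x<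

sorted⇒sublist : ∀ {N} c a (f : Fin c → Fin N) → (∀ i → toℕ (f i) ≡ a + toℕ i) →
  ∀ {V} → AllPairs _<_ V → All (Within a (a + c)) V →
  Sublist (λ x i → x ≡ toℕ i) V (tabulate f)
sorted⇒sublist zero    a f f≗ []       _ = []
sorted⇒sublist zero    a f f≗ (_ ∷ _) ((a≤x , x<a+0) ∷ _) =
  ⊥-elim (<⇒≱ (subst (_ <_) (+-identityʳ a) x<a+0) a≤x)
sorted⇒sublist (suc c) a f f≗ {[]} [] [] =
  f _ ∷ʳ sorted⇒sublist c (suc a) (f ∘ Fin.suc) (λ i → trans (f≗ _) (+-suc a _)) [] []
sorted⇒sublist (suc c) a f f≗ {x ∷ V} (x<V ∷ V↑) (x∈ ∷ V∈) with x ≟ a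
... | yes refl = sym (trans (f≗ _) (+-identityʳ x))
               ∷ sorted⇒sublist c (suc x) (f ∘ Fin.suc) (λ i → trans (f≗ _) (+-suc x _)) V↑
                   (All.zipWith (λ (x<y , y∈) → within-suc x<y y∈) (x<V , V∈))
... | no x≢a = f _ ∷ʳ sorted⇒sublist c (suc a) (f ∘ Fin.suc) (λ i → trans (f≗ _) (+-suc a _))
                 (x<V ∷ V↑) (All.zipWith (λ (a<y , y∈) → within-suc a<y y∈) (a<xV , x∈ ∷ V∈))
  where
    a<x : a < x
    a<x = ≤∧≢⇒< (proj₁ x∈) (x≢a ∘ sym)
    a<xV : All (a <_) (x ∷ V)
    a<xV = a<x ∷ All.map (<-trans a<x) x<V

module _ {A : Set} where

  upperRight lowerRight : ℕ → List (List A) → List (List A)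
  upperRight q M = map (drop q) (take q M)
  lowerRight q M = map (drop q) (drop q M)

IsCut : ℕ → List (List Bool) → Set
IsCut q M = All (All (_≡ false)) (upperRight q M)

FirstCut : ℕ → List (List Bool) → Set
FirstCut a M = 0 < a × IsCut a M × (∀ q → 0 < q → q < a → ¬ IsCut q M)

firstCut-unique : ∀ {a b M} → FirstCut a M → FirstCut b M → a ≡ b
firstCut-unique {a} {b} (0<a , cut-a , min-a) (0<b , cut-b , min-b) with <-cmp a b
... | tri< a<b _ _ = ⊥-elim (min-b a 0<a a<b cut-a)
... | tri≈ _ a≡b _ = a≡b
... | tri> _ _ b<a = ⊥-elim (min-a b 0<b b<a cut-b)

module Matrices (adj′ : ℕ → ℕ → Bool) where

  block : List ℕ → List ℕ → List (List Bool)
  block U W = map (λ u → map (adj′ u) W) U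

  matrix : List ℕ → List (List Bool)
  matrix V = block V V

  map-drop-block : ∀ q U W → map (drop q) (block U W) ≡ block U (drop q W)
  map-drop-block q U W = trans (sym (map-∘ U)) (map-cong (λ u → drop-map q W) U)

  upperRight-matrix : ∀ q V → upperRight q (matrix V) ≡ block (take q V) (drop q V)
  upperRight-matrix q V = trans (cong (map (drop q)) (take-map q V)) (map-drop-block q (take q V) V)

  lowerRight-matrix : ∀ q V → lowerRight q (matrix V) ≡ matrix (drop q V)
  lowerRight-matrix q V = trans (cong (map (drop q)) (drop-map q V)) (map-drop-block q (drop q V) V)

  NoEdges : List ℕ → List ℕ → Set
  NoEdges U W = ∀ {u w} → u ∈ U → w ∈ W → adj′ u w ≡ false

  noEdges⇒isCut : ∀ q V → NoEdges (take q V) (drop q V) → IsCut q (matrix V)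
  noEdges⇒isCut q V none = subst (All (All (_≡ false))) (sym (upperRight-matrix q V))
    (All.map⁺ (All.tabulate λ u∈ → All.map⁺ (All.tabulate (none u∈))))

  isCut⇒noEdges : ∀ q V → IsCut q (matrix V) → NoEdges (take q V) (drop q V)
  isCut⇒noEdges q V cut u∈ w∈ =
    All.lookup (All.map⁻ (All.lookup (All.map⁻ upper-zero) u∈)) w∈
    where upper-zero = subst (All (All (_≡ false))) (upperRight-matrix q V) cut

  Linked : ℕ → List ℕ → Set
  Linked a V = ∀ q → 0 < q → q < a →
    ∃₂ λ u w → u ∈ take q V × w ∈ drop q V × adj′ u w ≡ true

  firstCut-++ : ∀ P V → 0 < length P → Linked (length P) P → NoEdges P V →
    FirstCut (length P) (matrix (P ++ V))
  firstCut-++ P V 0<|P| linked none = 0<|P| , cut , minimal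
    where
      cut : IsCut (length P) (matrix (P ++ V))
      cut = noEdges⇒isCut (length P) (P ++ V) λ {u} {w} u∈ w∈ →
        none (subst (u ∈_) (take-length-++ P V) u∈) (subst (w ∈_) (drop-length-++ P V) w∈)
      minimal : ∀ q → 0 < q → q < length P → ¬ IsCut q (matrix (P ++ V))
      minimal q 0<q q<|P| cut-q with linked q 0<q q<|P|
      ... | u , w , u∈ , w∈ , uw =
        true≢false (trans (sym uw) (isCut⇒noEdges q (P ++ V) cut-q
          (subst (u ∈_) (sym (take-++ˡ q P V (<⇒≤ q<|P|))) u∈)
          (subst (w ∈_) (sym (drop-++ˡ q P V (<⇒≤ q<|P|))) (∈-++⁺ˡ w∈))))
        where
          true≢false : true ≢ false
          true≢false ()

  matrix-++-injective : ∀ P V W → matrix (P ++ V) ≡ matrix (P ++ W) → matrix V ≡ matrix W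
  matrix-++-injective P V W eq = begin
    matrix V                                       ≡⟨ cong matrix (drop-length-++ P V) ⟨
    matrix (drop (length P) (P ++ V))              ≡⟨ lowerRight-matrix (length P) (P ++ V) ⟨
    lowerRight (length P) (matrix (P ++ V))        ≡⟨ cong (lowerRight (length P)) eq ⟩
    lowerRight (length P) (matrix (P ++ W))        ≡⟨ lowerRight-matrix (length P) (P ++ W) ⟩
    matrix (drop (length P) (P ++ W))              ≡⟨ cong matrix (drop-length-++ P W) ⟩
    matrix W                                       ∎
    where open ≡-Reasoning

  Distinct : List (List ℕ) → Set
  Distinct = AllPairs (λ V W → matrix V ≢ matrix W)

  Family : (List ℕ → Set) → ℕ → Set
  Family P b = Σ (List (List ℕ)) λ Ls → All P Ls × Distinct Ls × b ≤ length Ls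

  family-map : ∀ {P Q b} → (∀ {V} → P V → Q V) → Family P b → Family Q b
  family-map f (Ls , P-Ls , dist , b≤) = Ls , All.map f P-Ls , dist , b≤

  family-≤ : ∀ {P b c} → c ≤ b → Family P b → Family P c
  family-≤ c≤b (Ls , P-Ls , dist , b≤) = Ls , P-Ls , dist , ≤-trans c≤b b≤

  family-++ : ∀ {P Q b c} → (∀ {V W} → P V → Q W → matrix V ≢ matrix W) →
    Family P b → Family Q c → Family (P ∪ Q) (b + c)
  family-++ apart (Ls , P-Ls , dL , b≤) (Ms , Q-Ms , dM , c≤) =
    Ls ++ Ms ,
    All.++⁺ (All.map inj₁ P-Ls) (All.map inj₂ Q-Ms) ,
    AllPairs.++⁺ dL dM (All.map (λ pV → All.map (apart pV) Q-Ms) P-Ls) ,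
    subst (_ ≤_) (sym (length-++ Ls)) (+-mono-≤ b≤ c≤)

  family-prefix : ∀ P {Q R b} → (∀ {V} → Q V → R (P ++ V)) → Family Q b → Family R b
  family-prefix P f (Ls , Q-Ls , dist , b≤) =
    map (P ++_) Ls ,
    All.map⁺ (All.map f Q-Ls) ,
    AllPairs.map⁺ (AllPairs.map (λ ne → ne ∘ matrix-++-injective P _ _) dist) ,
    subst (_ ≤_) (sym (length-map _ Ls)) b≤

range : ℕ → ℕ → List ℕ
range p zero    = []
range p (suc c) = p ∷ range (suc p) c

length-range : ∀ p c → length (range p c) ≡ c
length-range p zero    = refl
length-range p (suc c) = cong suc (length-range (suc p) c)

∈-range⁻ : ∀ p c {u} → u ∈ range p c → Within p (p + c) u
∈-range⁻ p (suc c) (here refl) = ≤-refl , m<m+n p z<s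
∈-range⁻ p (suc c) {u} (there u∈) with ∈-range⁻ (suc p) c u∈
... | p<u , u< = <⇒≤ p<u , subst (u <_) (sym (+-suc p c)) u<

∈-range⁺ : ∀ p c {u} → Within p (p + c) u → u ∈ range p c
∈-range⁺ p zero    {u} (p≤u , u<) = ⊥-elim (<⇒≱ (subst (u <_) (+-identityʳ p) u<) p≤u)
∈-range⁺ p (suc c) {u} (p≤u , u<) with u ≟ p
... | yes refl = here refl
... | no u≢p   = there (∈-range⁺ (suc p) c (≤∧≢⇒< p≤u (u≢p ∘ sym) , subst (u <_) (+-suc p c) u<))

range-sorted : ∀ p c → AllPairs _<_ (range p c)
range-sorted p zero    = []
range-sorted p (suc c) =
  All.tabulate (λ u∈ → proj₁ (∈-range⁻ (suc p) c u∈)) ∷ range-sorted (suc p) c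

take-range : ∀ q c p → q ≤ c → take q (range p c) ≡ range p q
take-range zero    c       p _         = refl
take-range (suc q) (suc c) p (s≤s q≤c) = cong (p ∷_) (take-range q c (suc p) q≤c)

drop-range : ∀ q c p → q ≤ c → drop q (range p c) ≡ range (p + q) (c ∸ q)
drop-range zero    c       p _         = cong (λ p′ → range p′ c) (sym (+-identityʳ p))
drop-range (suc q) (suc c) p (s≤s q≤c) =
  trans (drop-range q c (suc p) q≤c) (cong (λ p′ → range p′ (c ∸ q)) (sym (+-suc p q)))

+-assoc-4 : ∀ y ℓ → y + ℓ + ℓ + ℓ + ℓ ≡ y + (ℓ + ℓ + ℓ + ℓ)
+-assoc-4 = solve-∀

module Construction (adj′ : ℕ → ℕ → Bool) (ℓ s e : ℕ)
  (short : ∀ u v → u < v → adj′ u v ≡ true → v < u + ℓ)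
  (crossing : ∀ u → s ≤ u → suc u < e →
     ∃₂ λ i j → i ≤ u × u < j × j < e × adj′ i j ≡ true) where

  open Matrices adj′

  InCluster : ℕ → ℕ → ℕ → ℕ → Set
  InCluster p c j u = Within p (p + c) u ⊎ u ≡ j

  GapsCrossed : ℕ → ℕ → ℕ → Set
  GapsCrossed p c j = ∀ t → p < t → t ≤ j →
    ∃₂ λ u v → InCluster p c j u × InCluster p c j v × u < t × t ≤ v × adj′ u v ≡ true

  record Cluster (y c : ℕ) : Set where
    field
      p j      : ℕ
      y≤p      : y ≤ p
      p≤y+ℓ    : p ≤ y + ℓ
      p+c≤j    : p + c ≤ j
      y+ℓ≤j    : y + ℓ ≤ j
      j≤p+c+ℓ  : j ≤ p + c + ℓ
      crossed  : GapsCrossed p c j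

  inCluster-suc : ∀ {p c j u} → InCluster p c j u → InCluster p (suc c) j u
  inCluster-suc {p} {c} (inj₁ (p≤u , u<)) = inj₁ (p≤u , <-≤-trans u< (+-monoʳ-≤ p (n≤1+n c)))
  inCluster-suc         (inj₂ u≡j)         = inj₂ u≡j

  cluster-zero : ∀ y → Cluster y 0
  cluster-zero y = record
    { p = y + ℓ ; j = y + ℓ ; y≤p = m≤m+n y ℓ ; p≤y+ℓ = ≤-refl
    ; p+c≤j = ≤-reflexive (+-identityʳ (y + ℓ)) ; y+ℓ≤j = ≤-refl
    ; j≤p+c+ℓ = ≤-trans (≤-reflexive (sym (+-identityʳ (y + ℓ)))) (m≤m+n (y + ℓ + 0) ℓ)
    ; crossed = λ t p<t t≤p → ⊥-elim (<⇒≱ p<t t≤p) }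

  module _ {y c : ℕ} (C : Cluster y c) where
    open Cluster C

    grow-interval : p + c < j → Cluster y (suc c)
    grow-interval p+c<j = record
      { p = p ; j = j ; y≤p = y≤p ; p≤y+ℓ = p≤y+ℓ
      ; p+c≤j = subst (_≤ j) (sym (+-suc p c)) p+c<j ; y+ℓ≤j = y+ℓ≤j
      ; j≤p+c+ℓ = ≤-trans j≤p+c+ℓ (+-monoˡ-≤ ℓ (+-monoʳ-≤ p (n≤1+n c)))
      ; crossed = λ t p<t t≤j → case crossed t p<t t≤j of λ where
          (u , v , u∈ , v∈ , rest) → u , v , inCluster-suc u∈ , inCluster-suc v∈ , rest }

    module _ (p+c≡j : p + c ≡ j) {i j′ : ℕ} (j<j′ : j < j′) (j′<i+ℓ : j′ < i + ℓ)
             (edge : adj′ i j′ ≡ true) where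

      p+1+c≡1+j : p + suc c ≡ suc j
      p+1+c≡1+j = trans (+-suc p c) (cong suc p+c≡j)

      absorb-right : p ≤ i → i ≤ j → Cluster y (suc c)
      absorb-right p≤i i≤j = record
        { p = p ; j = j′ ; y≤p = y≤p ; p≤y+ℓ = p≤y+ℓ
        ; p+c≤j = subst (_≤ j′) (sym p+1+c≡1+j) j<j′
        ; y+ℓ≤j = ≤-trans y+ℓ≤j (<⇒≤ j<j′)
        ; j≤p+c+ℓ = <⇒≤ (<-≤-trans j′<i+ℓ (+-monoˡ-≤ ℓ (<⇒≤ i<p+1+c)))
        ; crossed = crossed′ }
        where
          i<p+1+c : i < p + suc c
          i<p+1+c = subst (i <_) (sym p+1+c≡1+j) (s≤s i≤j)
          j∈ : Within p (p + suc c) j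
          j∈ = subst (p ≤_) p+c≡j (m≤m+n p c) , subst (j <_) (sym p+1+c≡1+j) ≤-refl
          lift : ∀ {u} → InCluster p c j u → InCluster p (suc c) j′ u
          lift (inj₁ u∈) = inCluster-suc (inj₁ u∈)
          lift (inj₂ refl) = inj₁ j∈
          crossed′ : GapsCrossed p (suc c) j′
          crossed′ t p<t t≤j′ with t ≤? j
          ... | yes t≤j = case crossed t p<t t≤j of λ where
                  (u , v , u∈ , v∈ , rest) → u , v , lift u∈ , lift v∈ , rest
          ... | no t≰j = i , j′ , inj₁ (p≤i , i<p+1+c) , inj₂ refl ,
                         ≤-<-trans i≤j (≰⇒> t≰j) , t≤j′ , edge

      absorb-left : i < p → Cluster y (suc c)
      absorb-left i<p = record
        { p = i ; j = j′
        ; y≤p = <⇒≤ (+-cancelʳ-< ℓ y i (≤-<-trans (≤-trans y+ℓ≤j (<⇒≤ j<j′)) j′<i+ℓ))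
        ; p≤y+ℓ = ≤-trans (<⇒≤ i<p) p≤y+ℓ
        ; p+c≤j = subst (_≤ j′) (sym (+-suc i c))
                    (≤-trans (subst (suc (i + c) ≤_) p+c≡j (+-monoˡ-< c i<p)) (<⇒≤ j<j′))
        ; y+ℓ≤j = ≤-trans y+ℓ≤j (<⇒≤ j<j′)
        ; j≤p+c+ℓ = <⇒≤ (<-≤-trans j′<i+ℓ (+-monoˡ-≤ ℓ (m≤m+n i (suc c))))
        ; crossed = λ t i<t t≤j′ →
            i , j′ , inj₁ (≤-refl , m<m+n i z<s) , inj₂ refl , i<t , t≤j′ , edge }

    -- An edge i j′ crossing the gap after j either lengthens the interval to [p, j] (p ≤ i),
    -- or alone crosses every gap of the new cluster [i, i + c] ∪ {j′} (i < p).
    absorb : p + c ≡ j → s ≤ y → suc j < e → Cluster y (suc c)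
    absorb p+c≡j s≤y 1+j<e
      with crossing j (≤-trans s≤y (≤-trans y≤p (≤-trans (m≤m+n p c) p+c≤j))) 1+j<e
    ... | i , j′ , i≤j , j<j′ , j′<e , edge with p ≤? i
    ...   | yes p≤i = absorb-right p+c≡j j<j′ j′<i+ℓ edge p≤i i≤j
      where j′<i+ℓ = short i j′ (≤-<-trans i≤j j<j′) edge
    ...   | no  p≰i = absorb-left p+c≡j j<j′ j′<i+ℓ edge (≰⇒> p≰i)
      where j′<i+ℓ = short i j′ (≤-<-trans i≤j j<j′) edge

  cluster : ∀ y c → s ≤ y → y + ℓ + c + ℓ < e → Cluster y c
  cluster y zero    _   _     = cluster-zero y
  cluster y (suc c) s≤y bound
    with cluster y c s≤y (≤-<-trans (+-monoˡ-≤ ℓ (+-monoʳ-≤ (y + ℓ) (n≤1+n c))) bound)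
  ... | C with Cluster.p C + c <? Cluster.j C
  ...   | yes p+c<j = grow-interval C p+c<j
  ...   | no  p+c≮j = absorb C (≤-antisym (Cluster.p+c≤j C) (≮⇒≥ p+c≮j)) s≤y 1+j<e
    where
      j≤y+ℓ+c+ℓ : Cluster.j C ≤ y + ℓ + c + ℓ
      j≤y+ℓ+c+ℓ = ≤-trans (Cluster.j≤p+c+ℓ C) (+-monoˡ-≤ ℓ (+-monoˡ-≤ c (Cluster.p≤y+ℓ C)))
      1+j<e : suc (Cluster.j C) < e
      1+j<e = ≤-<-trans (s≤s j≤y+ℓ+c+ℓ) (subst (_< e) (cong (_+ ℓ) (+-suc (y + ℓ) c)) bound)

  module _ {y c : ℕ} (C : Cluster y c) where
    open Cluster C

    elements : List ℕ
    elements = range p c ++ [ j ]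

    length-elements : length elements ≡ suc c
    length-elements = trans (length-++ (range p c)) (trans (cong (_+ 1) (length-range p c)) (+-comm c 1))

    elements-sorted : AllPairs _<_ elements
    elements-sorted = AllPairs.++⁺ (range-sorted p c) ([] ∷ [])
      (All.tabulate λ u∈ → <-≤-trans (proj₂ (∈-range⁻ p c u∈)) p+c≤j ∷ [])

    elements-bounded : All (λ x → y ≤ x × x ≤ y + ℓ + c + ℓ) elements
    elements-bounded = All.tabulate λ {x} x∈ → bounds (∈-elements x∈)
      where
        j≤y+ℓ+c+ℓ : j ≤ y + ℓ + c + ℓ
        j≤y+ℓ+c+ℓ = ≤-trans j≤p+c+ℓ (+-monoˡ-≤ ℓ (+-monoˡ-≤ c p≤y+ℓ))
        ∈-elements : ∀ {x} → x ∈ elements → InCluster p c j x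
        ∈-elements x∈ with ∈-++⁻ (range p c) x∈
        ... | inj₁ x∈range       = inj₁ (∈-range⁻ p c x∈range)
        ... | inj₂ (here x≡j)    = inj₂ x≡j
        bounds : ∀ {x} → InCluster p c j x → y ≤ x × x ≤ y + ℓ + c + ℓ
        bounds (inj₁ (p≤x , x<p+c)) =
          ≤-trans y≤p p≤x , ≤-trans (<⇒≤ (<-≤-trans x<p+c p+c≤j)) j≤y+ℓ+c+ℓ
        bounds (inj₂ refl) = ≤-trans y≤p (≤-trans (m≤m+n p c) p+c≤j) , j≤y+ℓ+c+ℓ

    module _ {q : ℕ} (q≤c : q ≤ c) where

      p+q≤j : p + q ≤ j
      p+q≤j = ≤-trans (+-monoʳ-≤ p q≤c) p+c≤j

      q≤|range| : q ≤ length (range p c)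
      q≤|range| = subst (q ≤_) (sym (length-range p c)) q≤c

      take-elements : take q elements ≡ range p q
      take-elements = trans (take-++ˡ q (range p c) [ j ] q≤|range|) (take-range q c p q≤c)

      drop-elements : drop q elements ≡ range (p + q) (c ∸ q) ++ [ j ]
      drop-elements = trans (drop-++ˡ q (range p c) [ j ] q≤|range|)
                            (cong (_++ [ j ]) (drop-range q c p q≤c))

      ∈-take-elements : ∀ {u} → InCluster p c j u → u < p + q → u ∈ take q elements
      ∈-take-elements (inj₁ (p≤u , _)) u<p+q =
        subst (_ ∈_) (sym take-elements) (∈-range⁺ p q (p≤u , u<p+q))
      ∈-take-elements (inj₂ refl) u<p+q = ⊥-elim (<⇒≱ u<p+q p+q≤j)

      ∈-drop-elements : ∀ {v} → InCluster p c j v → p + q ≤ v → v ∈ drop q elements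
      ∈-drop-elements {v} (inj₁ (_ , v<p+c)) p+q≤v = subst (v ∈_) (sym drop-elements)
        (∈-++⁺ˡ (∈-range⁺ (p + q) (c ∸ q) (p+q≤v , subst (v <_) (sym p+q+[c∸q]≡p+c) v<p+c)))
        where
          p+q+[c∸q]≡p+c : p + q + (c ∸ q) ≡ p + c
          p+q+[c∸q]≡p+c = trans (+-assoc p q (c ∸ q)) (cong (p +_) (m+[n∸m]≡n q≤c))
      ∈-drop-elements (inj₂ refl) _ = subst (_ ∈_) (sym drop-elements) (∈-++⁺ʳ _ (here refl))

    elements-linked : Linked (suc c) elements
    elements-linked q 0<q (s≤s q≤c) with crossed (p + q) (m<m+n p 0<q) (p+q≤j q≤c)
    ... | u , v , u∈ , v∈ , u<p+q , p+q≤v , edge =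
      u , v , ∈-take-elements q≤c u∈ u<p+q , ∈-drop-elements q≤c v∈ p+q≤v , edge

  linkedSet : ∀ y c → c < ℓ → s ≤ y → y + ℓ + ℓ + ℓ ≤ e →
    Σ (List ℕ) λ P → length P ≡ suc c × AllPairs _<_ P ×
      All (Within y (y + ℓ + ℓ + ℓ)) P × Linked (length P) P
  linkedSet y c c<ℓ s≤y y+3ℓ≤e =
    elements C , length-elements C , elements-sorted C ,
    All.map (λ (y≤x , x≤) → y≤x , ≤-<-trans x≤ y+ℓ+c+ℓ<y+3ℓ) (elements-bounded C) ,
    subst (λ a → Linked a (elements C)) (sym (length-elements C)) (elements-linked C)
    where
      y+ℓ+c+ℓ<y+3ℓ : y + ℓ + c + ℓ < y + ℓ + ℓ + ℓ
      y+ℓ+c+ℓ<y+3ℓ = +-monoˡ-< ℓ (+-monoʳ-< (y + ℓ) c<ℓ)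
      C = cluster y c s≤y (<-≤-trans y+ℓ+c+ℓ<y+3ℓ y+3ℓ≤e)

  noEdges-apart : ∀ {U W} z → All (λ u → u + ℓ < z) U → All (z ≤_) W → NoEdges U W
  noEdges-apart z U-below W-above {u} {w} u∈ w∈ = ¬-not λ edge →
    <⇒≱ (short u w (≤-<-trans (m≤m+n u ℓ) u+ℓ<w) edge) (<⇒≤ u+ℓ<w)
    where
      u+ℓ<w = <-≤-trans (All.lookup U-below u∈) (All.lookup W-above w∈)

  K : ℕ
  K = ℓ + ℓ + ℓ + ℓ

  WindowSet : ℕ → ℕ → List ℕ → Set
  WindowSet y n V = length V ≡ n × AllPairs _<_ V × All (Within y (y + n * K)) V

  clearance : ∀ y {u} → u < y + ℓ + ℓ + ℓ → u + ℓ < y + K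
  clearance y {u} u< = subst (u + ℓ <_) (+-assoc-4 y ℓ) (+-monoˡ-< ℓ u<)

  module _ (y : ℕ) {n r : ℕ} (1+r≤n : suc r ≤ n) where

    next-window-end : y + K + r * K ≤ y + n * K
    next-window-end = subst (_≤ y + n * K) (sym (+-assoc y K (r * K))) (+-monoʳ-≤ y (*-monoˡ-≤ K 1+r≤n))

    window-++ : ∀ {P V} → length P + r ≡ n → AllPairs _<_ P →
      All (Within y (y + ℓ + ℓ + ℓ)) P → WindowSet (y + K) r V → WindowSet y n (P ++ V)
    window-++ {P} {V} |P|+r≡n P↑ P-within (|V|≡r , V↑ , V-within) =
      trans (length-++ P) (trans (cong (length P +_) |V|≡r) |P|+r≡n) ,
      AllPairs.++⁺ P↑ V↑
        (All.map (λ u∈ → All.map (λ v∈ → <-≤-trans (below u∈) (proj₁ v∈)) V-within) P-within) ,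
      All.++⁺ (All.map (λ u∈ → proj₁ u∈ , <-≤-trans (below u∈) y+K≤end) P-within)
              (All.map (λ v∈ → ≤-trans (m≤m+n y K) (proj₁ v∈) , <-≤-trans (proj₂ v∈) next-window-end)
                       V-within)
      where
        below : ∀ {u} → Within y (y + ℓ + ℓ + ℓ) u → u < y + K
        below {u} (_ , u<) = ≤-<-trans (m≤m+n u ℓ) (clearance y u<)
        y+K≤end : y + K ≤ y + n * K
        y+K≤end = ≤-trans (m≤m+n (y + K) (r * K)) next-window-end

  linked-++ : ∀ y {r P V} → 0 < length P → Linked (length P) P →
    All (Within y (y + ℓ + ℓ + ℓ)) P → WindowSet (y + K) r V → FirstCut (length P) (matrix (P ++ V))
  linked-++ y {P = P} {V} 0<|P| linked P-within (_ , _ , V-within) = firstCut-++ P V 0<|P| linked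
    (noEdges-apart (y + K) (All.map (clearance y ∘ proj₂) P-within) (All.map proj₁ V-within))

  firstCutFamily : ∀ y {n c r} → s ≤ y → y + n * K ≤ e → suc c + r ≡ n → c < ℓ →
    Family (WindowSet (y + K) r) (F r ℓ) →
    Family (λ V → WindowSet y n V × FirstCut (suc c) (matrix V)) (F r ℓ)
  firstCutFamily y {n} {c} {r} s≤y y+nK≤e 1+c+r≡n c<ℓ rest =
    case linkedSet y c c<ℓ s≤y y+3ℓ≤e of λ where
      (P , |P|≡1+c , P↑ , P-within , linked) → family-prefix P (λ {V} wV →
        window-++ y 1+r≤n (trans (cong (_+ r) |P|≡1+c) 1+c+r≡n) P↑ P-within wV ,
        subst (λ a → FirstCut a (matrix (P ++ V))) |P|≡1+c
          (linked-++ y (subst (0 <_) (sym |P|≡1+c) z<s) linked P-within wV)) rest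
    where
      1+r≤n : suc r ≤ n
      1+r≤n = subst (suc r ≤_) 1+c+r≡n (s≤s (m≤n+m r c))
      y+K+rK≤e : y + K + r * K ≤ e
      y+K+rK≤e = ≤-trans (next-window-end y 1+r≤n) y+nK≤e
      y+3ℓ≤e : y + ℓ + ℓ + ℓ ≤ e
      y+3ℓ≤e = ≤-trans (subst (y + ℓ + ℓ + ℓ ≤_) (+-assoc-4 y ℓ) (m≤m+n _ ℓ))
                 (≤-trans (m≤m+n (y + K) (r * K)) y+K+rK≤e)

  CutAbove : ℕ → List ℕ → Set
  CutAbove c V = ∃ λ b → c < b × FirstCut b (matrix V)

  module Gather (n′ : ℕ) (Valid : List ℕ → Set)
    (groups : ∀ c r → c + r ≡ n′ → c < ℓ →
       Family (λ V → Valid V × FirstCut (suc c) (matrix V)) (F r ℓ)) where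

    -- The first cuts c + 1, …, c + d contribute F r, F (r − 1), …, the first d entries of hist ℓ r.
    gather : ∀ d c r → c + d ≤ ℓ → c + r ≡ n′ →
      Family (λ V → Valid V × CutAbove c V) (sum (take d (hist ℓ r)))
    gather zero    c r       _       _ = [] , [] , [] , z≤n
    gather (suc d) c zero    c+1+d≤ℓ  c+0≡n′ =
      family-≤ (≤-reflexive (cong (suc ∘ sum) (take-[] d)))
        (family-map (λ (v , cut) → v , suc c , ≤-refl , cut)
          (groups c zero c+0≡n′ (<-≤-trans (m<m+n c z<s) c+1+d≤ℓ)))
    gather (suc d) c (suc r) c+1+d≤ℓ c+r≡n′ =
      family-map (either (λ (v , cut) → v , suc c , ≤-refl , cut)
                         (λ (v , b , 1+c<b , cut) → v , b , <-trans (n<1+n c) 1+c<b , cut))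
        (family-++ apart
          (groups c (suc r) c+r≡n′ (<-≤-trans (m<m+n c z<s) c+1+d≤ℓ))
          (gather d (suc c) r (subst (_≤ ℓ) (+-suc c d) c+1+d≤ℓ) (trans (sym (+-suc c r)) c+r≡n′)))
      where
        apart : ∀ {V W} → Valid V × FirstCut (suc c) (matrix V) →
          Valid W × CutAbove (suc c) W → matrix V ≢ matrix W
        apart (_ , cut) (_ , b , 1+c<b , cut′) eq =
          <-irrefl (firstCut-unique cut (subst (FirstCut b) (sym eq) cut′)) 1+c<b

  Selections : ℕ → Set
  Selections n = ∀ y → s ≤ y → y + n * K ≤ e → Family (WindowSet y n) (F n ℓ)

  selections : ∀ n → Selections n
  selections = <-rec Selections step
    where
      step : ∀ n → (∀ {r} → r < n → Selections r) → Selections n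
      step zero     _   y _   _      = [] ∷ [] , (refl , [] , []) ∷ [] , [] ∷ [] , ≤-refl
      step (suc n′) rec y s≤y y+nK≤e =
        family-map proj₁ (Gather.gather n′ (WindowSet y (suc n′)) groups ℓ 0 n′ ≤-refl refl)
        where
          groups : ∀ c r → c + r ≡ n′ → c < ℓ →
            Family (λ V → WindowSet y (suc n′) V × FirstCut (suc c) (matrix V)) (F r ℓ)
          groups c r c+r≡n′ c<ℓ = firstCutFamily y s≤y y+nK≤e (cong suc c+r≡n′) c<ℓ
            (rec r<n (y + K) (≤-trans s≤y (m≤m+n y K)) (≤-trans (next-window-end y r<n) y+nK≤e))
            where
              r<n : r < suc n′
              r<n = s≤s (subst (r ≤_) c+r≡n′ (m≤n+m r c))

-- Vertices outside [0, N) are isolated.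
adjAt : ∀ {N} → OGraph N → ℕ → ℕ → Bool
adjAt {N} G x y with x <? N | y <? N
... | yes x<N | yes y<N = adj G (fromℕ< x<N) (fromℕ< y<N)
... | _       | _       = false

adjAt-toℕ : ∀ {N} (G : OGraph N) i j → adjAt G (toℕ i) (toℕ j) ≡ adj G i j
adjAt-toℕ {N} G i j with toℕ i <? N | toℕ j <? N
... | yes i<N | yes j<N = cong₂ (adj G) (fromℕ<-toℕ i i<N) (fromℕ<-toℕ j j<N)
... | no i≮N  | _       = ⊥-elim (i≮N (toℕ<n i))
... | yes _   | no j≮N  = ⊥-elim (j≮N (toℕ<n j))

adjAt-true : ∀ {N} (G : OGraph N) x y → adjAt G x y ≡ true →
  ∃₂ λ i j → toℕ i ≡ x × toℕ j ≡ y × Edge G i j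
adjAt-true {N} G x y edge with x <? N | y <? N
... | yes x<N | yes y<N = fromℕ< x<N , fromℕ< y<N , toℕ-fromℕ< x<N , toℕ-fromℕ< y<N , edge
... | yes _   | no  _   with () ← edge
... | no  _   | _       with () ← edge

ℓ-empty⇒short : ∀ {N ℓ} (G : OGraph N) → LEmpty ℓ G →
  ∀ u v → u < v → adjAt G u v ≡ true → v < u + ℓ
ℓ-empty⇒short {ℓ = ℓ} G ℓ-empty u v u<v edge with adjAt-true G u v edge
... | i , j , refl , refl , e = ℓ-empty i j u<v e

irreducible⇒crossing : ∀ {m} (H : OGraph m) → Irreducible H → ∀ u → suc u < m →
  ∃₂ λ x y → toℕ x ≤ u × u < toℕ y × Edge H x y
irreducible⇒crossing H irr u 1+u<m
  with any? (λ x → any? (λ y → toℕ x ≤? u ×-dec u <? toℕ y ×-dec adj H x y ≟ᵇ true))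
... | yes (x , y , crossing) = x , y , crossing
... | no  none = ⊥-elim (irr (fromℕ< u<m) (fromℕ< 1+u<m) u<1+u separated)
  where
    u<m = <-trans (n<1+n u) 1+u<m
    u<1+u : toℕ (fromℕ< u<m) < toℕ (fromℕ< 1+u<m)
    u<1+u = subst₂ _<_ (sym (toℕ-fromℕ< u<m)) (sym (toℕ-fromℕ< 1+u<m)) (n<1+n u)
    separated : Separates H (fromℕ< u<m) (fromℕ< 1+u<m)
    separated i j _ e with toℕ j ≤? u | toℕ i ≤? u
    ... | yes j≤u | _       = inj₁ (subst (toℕ j ≤_) (sym (toℕ-fromℕ< u<m)) j≤u)
    ... | no  j≰u | yes i≤u = ⊥-elim (none (i , j , i≤u , ≰⇒> j≰u , e))
    ... | no  _   | no  i≰u = inj₂ (subst (_≤ toℕ i) (sym (toℕ-fromℕ< 1+u<m)) (≰⇒> i≰u))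

toℕ-embed : ∀ {N} (b : Block N) x → toℕ (embed b x) ≡ start b + toℕ x
toℕ-embed b x = toℕ-fromℕ< _

block-crossing : ∀ {N} (G : OGraph N) (b : Block N) → Irreducible (induced b G) →
  ∀ u → start b ≤ u → suc u < start b + size b →
  ∃₂ λ i j → i ≤ u × u < j × j < start b + size b × adjAt G i j ≡ true
block-crossing G b irr u s≤u 1+u<e with m≤n⇒∃[o]m+o≡n s≤u
... | u′ , refl with irreducible⇒crossing (induced b G) irr u′
                       (+-cancelˡ-< (start b) (suc u′) (size b)
                         (subst (_< start b + size b) (sym (+-suc (start b) u′)) 1+u<e))
... | x , y , x≤u′ , u′<y , edge =
  start b + toℕ x , start b + toℕ y ,
  +-monoʳ-≤ (start b) x≤u′ , +-monoʳ-< (start b) u′<y , +-monoʳ-< (start b) (toℕ<n y) ,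
  trans (cong₂ (adjAt G) (sym (toℕ-embed b x)) (sym (toℕ-embed b y))) (trans (adjAt-toℕ G _ _) edge)

module _ {N : ℕ} (G : OGraph N) where
  open Matrices (adjAt G)

  matrix-toℕ : ∀ (W : List (Fin N)) → matrix (map toℕ W) ≡ adjMatrix G W
  matrix-toℕ W = trans (sym (map-∘ W))
    (map-cong (λ i → trans (sym (map-∘ W)) (map-cong (adjAt-toℕ G i) W)) W)

  pointwise⇒map-toℕ : ∀ {V} {W : List (Fin N)} → Pointwise (λ x i → x ≡ toℕ i) V W → V ≡ map toℕ W
  pointwise⇒map-toℕ []          = refl
  pointwise⇒map-toℕ (x≡i ∷ V∼W) = cong₂ _∷_ x≡i (pointwise⇒map-toℕ V∼W)

  matrix∈subgraphs : ∀ {V} → AllPairs _<_ V → All (_< N) V →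
    matrix V ∈ map (adjMatrix G) (subsets (length V) (allFin N))
  matrix∈subgraphs V↑ V<N
    with sublist⇒∈subsets (sorted⇒sublist N 0 id (λ _ → refl) V↑ (All.map (z≤n ,_) V<N))
  ... | W , W∈ , V∼W =
    subst (_∈ _) (trans (sym (matrix-toℕ W)) (cong matrix (sym (pointwise⇒map-toℕ V∼W))))
      (∈-map⁺ (adjMatrix G) W∈)

  family⇒≤S : ∀ n {b} → Family (λ V → length V ≡ n × AllPairs _<_ V × All (_< N) V) b → b ≤ S n G
  family⇒≤S n (Ls , Ls-ok , distinct , b≤) = ≤-trans b≤ (subst (_≤ S n G) (length-map matrix Ls)
    (unique⊆⇒length≤ {ys = deduplicate (≡-dec (≡-dec _≟ᵇ_)) (map (adjMatrix G) (subsets n (allFin N)))}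
      (AllPairs.map⁺ distinct)
      (All.map⁺ (All.map (λ { (refl , V↑ , V<N) →
        ∈-deduplicate⁺ (≡-dec (≡-dec _≟ᵇ_)) (matrix∈subgraphs V↑ V<N) }) Ls-ok))))

k*K≡4*k*ℓ : ∀ k ℓ → k * (ℓ + ℓ + ℓ + ℓ) ≡ 4 * k * ℓ
k*K≡4*k*ℓ = solve-∀

lemma5p3 : ∀ (k ℓ N : ℕ) (G : OGraph N) → LEmpty ℓ G →
    (D : List (Block N)) → IsIrredBlockDecomp G D →
    Any (λ b → 4 * k * ℓ ≤ size b) D →
    ∀ (n : ℕ) → n ≤ k → F n ℓ ≤ S n G
lemma5p3 k ℓ N G ℓ-empty D (_ , irreducible , _) large n n≤k
  with All.lookupAny irreducible large
... | irr , 4kℓ≤size = family⇒≤S G n (family-map within-N (selections n (start b) ≤-refl s+nK≤e))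
  where
    b = Any.lookup large
    open Matrices (adjAt G)
    open Construction (adjAt G) ℓ (start b) (start b + size b)
           (ℓ-empty⇒short G ℓ-empty) (block-crossing G b irr)
    s+nK≤e : start b + n * K ≤ start b + size b
    s+nK≤e = +-monoʳ-≤ (start b)
      (≤-trans (*-monoˡ-≤ K n≤k) (subst (_≤ size b) (sym (k*K≡4*k*ℓ k ℓ)) 4kℓ≤size))
    within-N : ∀ {V} → WindowSet (start b) n V → length V ≡ n × AllPairs _<_ V × All (_< N) V
    within-N (|V| , V↑ , V-within) =
      |V| , V↑ , All.map (λ (_ , v<) → <-≤-trans v< (≤-trans s+nK≤e (bound b))) V-within
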